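{- Every finite graph $G_1=(V_1,E_1)$ has a subgraph $G'_1$ on the vertex set $V_1$ (i.e. $G'_1=(V_1,E'_1)$ with $E'_1\subseteq E_1$) such that for each $v\in V_1$: $$d_{G'_1}(v)\in\left[\tfrac{9}{16}d_{G_1}(v)-3,\ \tfrac{9}{16}d_{G_1}(v)+3\right].$$
   Context: $d_H(v)$ denotes the degree of vertex $v$ in graph $H$. -}

module Defs where

open import Data.Nat using (ℕ)
open import Data.Bool using (Bool; true; false; T)
open import Data.Fin using (Fin)
open import Data.List using (List; length; filter)
open import Relation.Binary.PropositionalEquality using (_≡_)
open import Data.Bool.Properties using (T?)
open import Data.List using (allFin)

record Graph (n : ℕ) : Set where
  field
    adj   : Fin n → Fin n → Bool
    sym   : ∀ u v → adj u v ≡ adj v u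
    irrefl : ∀ v → adj v v ≡ false
open Graph public

degree : ∀ {n} → Graph n → Fin n → ℕ
degree G v = length (filter (λ u → T? (adj G v u)) (allFin _))

_⊆ᴳ_ : ∀ {n} → Graph n → Graph n → Set
H ⊆ᴳ G = ∀ u v → T (adj H u v) → T (adj G u v)

module Submission where

-- Engine: every bipartite multigraph (a matrix of edge multiplicities) splits
-- into red and blue edges whose degrees differ by at most one at each vertex.
-- Induction on the number of edges: at a vertex x with edges xa, xb, either a
-- path y–b–x–a is shortcut to the edge y–a, or xa, xb form a pendant star; a
-- split of the smaller multigraph extends in both cases.  Orienting the edges
-- of G from smaller to larger endpoint makes G bipartite, with out- plus
-- in-degree equal to d_G(v); its red part is a "half" H, |2 d_H - d_G| ≤ 2.
-- Halving repeatedly gives 2^-r-fractions, and G' = H ∪ K, with K an eighth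
-- of G ∖ H, has degree about d/2 + d/16 = 9d/16.  The file follows this
-- order: distances, sums, matrices, splits, orientation and halves,
-- fractions, differences and unions of subgraphs, arithmetic, corollary.

open import Defs hiding (sym)
open import Data.Nat using (ℕ; _≤_; _*_; _+_)
open import Data.Product using (Σ; _×_)

open import Data.Bool using (Bool; true; false; T; _∧_; _∨_; not)
open import Data.Bool.Properties using (T?; ∧-identityʳ; ∧-zeroʳ; T-∧; T-∨; T-not-≡)
open import Data.Empty using (⊥; ⊥-elim)
open import Data.Fin using (Fin; zero; suc)
open import Data.Fin.Properties using (any?) renaming (_<?_ to _<ᶠ?_; <-cmp to <ᶠ-cmp)
open import Data.List using (length; filter; tabulate)
open import Data.Nat using (zero; suc; _∸_; _<_; _^_; _<ᵇ_; ∣_-_∣; z≤n; s≤s; _≤?_)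
open import Data.Nat.Induction using (<-wellFounded)
open import Data.Nat.Properties
open import Algebra.Properties.CommutativeSemigroup +-commutativeSemigroup using (xy∙z≈xz∙y; interchange)
open import Algebra.Properties.Semiring.Sum +-*-semiring
  using (sum; ∑-distrib-+; ∑-comm; sum-cong-≗; *-distribˡ-sum; *-distribʳ-sum; sum-replicate-zero)
open import Data.Nat.Tactic.RingSolver using (solve-∀)
open import Data.Product using (_,_; proj₁; proj₂; ∃-syntax)
open import Data.Sum using (_⊎_; inj₁; inj₂)
open import Data.Unit using (tt)
open import Function using (_∘_; Equivalence)
open import Induction.WellFounded using (module All)
open import Level using (0ℓ)
import Relation.Binary.Construct.On as On
open import Relation.Binary.Definitions using (tri<; tri≈; tri>)
open import Relation.Binary.PropositionalEquality
open import Relation.Nullary using (yes; no)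
open import Relation.Nullary.Decidable using (does; dec-true; dec-false)

∣-∣-+ʳ : ∀ p q k → ∣ p + k - q + k ∣ ≡ ∣ p - q ∣
∣-∣-+ʳ p q k = begin
  ∣ p + k - q + k ∣ ≡⟨ cong₂ ∣_-_∣ (+-comm p k) (+-comm q k) ⟩
  ∣ k + p - k + q ∣ ≡⟨ ∣m+n-m+o∣≡∣n-o∣ k p q ⟩
  ∣ p - q ∣         ∎
  where open ≡-Reasoning

∣-∣-+-≤ : ∀ a b c d → ∣ a + c - b + d ∣ ≤ ∣ a - b ∣ + ∣ c - d ∣
∣-∣-+-≤ a b c d = begin
  ∣ a + c - b + d ∣                     ≤⟨ ∣-∣-triangle (a + c) (b + c) (b + d) ⟩
  ∣ a + c - b + c ∣ + ∣ b + c - b + d ∣ ≡⟨ cong₂ _+_ (∣-∣-+ʳ a b c) (∣m+n-m+o∣≡∣n-o∣ b c d) ⟩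
  ∣ a - b ∣ + ∣ c - d ∣                 ∎
  where open ≤-Reasoning

∣double-sum∣ : ∀ x y → ∣ 2 * x - x + y ∣ ≡ ∣ x - y ∣
∣double-sum∣ x y = begin
  ∣ 2 * x - x + y ∣ ≡⟨ cong (∣_- x + y ∣) (cong (x +_) (+-identityʳ x)) ⟩
  ∣ x + x - x + y ∣ ≡⟨ ∣m+n-m+o∣≡∣n-o∣ x x y ⟩
  ∣ x - y ∣         ∎
  where open ≡-Reasoning

∣-∣≤1 : ∀ {p q} → p ≤ 1 → q ≤ 1 → ∣ p - q ∣ ≤ 1
∣-∣≤1 {p} {q} p≤1 q≤1 = ≤-trans (∣m-n∣≤m⊔n p q) (⊔-lub p≤1 q≤1)

∣-∣≤⇒bounds : ∀ {p q e} → ∣ p - q ∣ ≤ e → (q ≤ p + e) × (p ≤ q + e)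
∣-∣≤⇒bounds {p} {q} d≤e =
  ≤-trans (m≤n+∣n-m∣ q p) (+-monoʳ-≤ p d≤e) , ≤-trans (m≤n+∣m-n∣ p q) (+-monoʳ-≤ q d≤e)

sum-positive : ∀ {k} (f : Fin k → ℕ) → 0 < sum f → ∃[ i ] 0 < f i
sum-positive {suc k} f pos with f zero in eq
... | suc _ = zero , subst (0 <_) (sym eq) (s≤s z≤n)
... | zero  with sum-positive (f ∘ suc) pos
...   | i , fi>0 = suc i , fi>0

δ : ∀ {k} → Fin k → Fin k → ℕ
δ zero    zero    = 1
δ zero    (suc _) = 0
δ (suc _) zero    = 0
δ (suc i) (suc j) = δ i j

δ-diag : ∀ {k} (i : Fin k) → δ i i ≡ 1
δ-diag zero    = refl
δ-diag (suc i) = δ-diag i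

δ-view : ∀ {k} (i j : Fin k) → i ≡ j ⊎ δ i j ≡ 0
δ-view zero    zero    = inj₁ refl
δ-view zero    (suc j) = inj₂ refl
δ-view (suc i) zero    = inj₂ refl
δ-view (suc i) (suc j) with δ-view i j
... | inj₁ i≡j = inj₁ (cong suc i≡j)
... | inj₂ δ≡0 = inj₂ δ≡0

δ-≤1 : ∀ {k} (i j : Fin k) → δ i j ≤ 1
δ-≤1 i j with δ-view i j
... | inj₁ refl = ≤-reflexive (δ-diag i)
... | inj₂ δ≡0 = subst (_≤ 1) (sym δ≡0) z≤n

sum-δ : ∀ {k} (i : Fin k) → sum (δ i) ≡ 1
sum-δ {suc k} zero    = cong suc (sum-replicate-zero k)
sum-δ         (suc i) = sum-δ i

-- Bipartite multigraphs with sides Fin m and Fin n, given by their matrix of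
-- edge multiplicities; row and column sums are the degrees on either side.
Mx : ℕ → ℕ → Set
Mx m n = Fin m → Fin n → ℕ

module _ {m n : ℕ} where

  row : Mx m n → Fin m → ℕ
  row N x = sum (N x)

  col : Mx m n → Fin n → ℕ
  col N a = sum (λ x → N x a)

  tot : Mx m n → ℕ
  tot N = sum (row N)

  _≐_ : Mx m n → Mx m n → Set
  M ≐ N = ∀ x a → M x a ≡ N x a

  row-cong : ∀ {M N} → M ≐ N → ∀ x → row M x ≡ row N x
  row-cong M≐N x = sum-cong-≗ (M≐N x)

  col-cong : ∀ {M N} → M ≐ N → ∀ a → col M a ≡ col N a
  col-cong M≐N a = sum-cong-≗ (λ x → M≐N x a)

  tot-cong : ∀ {M N} → M ≐ N → tot M ≡ tot N
  tot-cong M≐N = sum-cong-≗ (row-cong M≐N)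

  bump : Mx m n → Fin m → Fin n → Mx m n
  bump N x a u w = N u w + δ x u * δ a w

  bump-cong : ∀ {M N} x a → M ≐ N → bump M x a ≐ bump N x a
  bump-cong x a M≐N u w = cong (_+ δ x u * δ a w) (M≐N u w)

  bump-comm : ∀ N x a y b → bump (bump N x a) y b ≐ bump (bump N y b) x a
  bump-comm N x a y b u w = xy∙z≈xz∙y (N u w) (δ x u * δ a w) (δ y u * δ b w)

  row-bump : ∀ N x a u → row (bump N x a) u ≡ row N u + δ x u
  row-bump N x a u = begin
    sum (λ w → N u w + δ x u * δ a w)    ≡⟨ ∑-distrib-+ (N u) (λ w → δ x u * δ a w) ⟩
    row N u + sum (λ w → δ x u * δ a w)  ≡⟨ cong (row N u +_) (*-distribˡ-sum (δ x u) (δ a)) ⟨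
    row N u + δ x u * sum (δ a)          ≡⟨ cong (λ s → row N u + δ x u * s) (sum-δ a) ⟩
    row N u + δ x u * 1                  ≡⟨ cong (row N u +_) (*-identityʳ (δ x u)) ⟩
    row N u + δ x u                      ∎
    where open ≡-Reasoning

  col-bump : ∀ N x a w → col (bump N x a) w ≡ col N w + δ a w
  col-bump N x a w = begin
    sum (λ u → N u w + δ x u * δ a w)    ≡⟨ ∑-distrib-+ (λ u → N u w) (λ u → δ x u * δ a w) ⟩
    col N w + sum (λ u → δ x u * δ a w)  ≡⟨ cong (col N w +_) (*-distribʳ-sum (δ a w) (δ x)) ⟨
    col N w + sum (δ x) * δ a w          ≡⟨ cong (λ s → col N w + s * δ a w) (sum-δ x) ⟩
    col N w + 1 * δ a w                  ≡⟨ cong (col N w +_) (*-identityˡ (δ a w)) ⟩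
    col N w + δ a w                      ∎
    where open ≡-Reasoning

  tot-bump : ∀ N x a → tot (bump N x a) ≡ suc (tot N)
  tot-bump N x a = begin
    sum (row (bump N x a))          ≡⟨ sum-cong-≗ (row-bump N x a) ⟩
    sum (λ u → row N u + δ x u)     ≡⟨ ∑-distrib-+ (row N) (δ x) ⟩
    tot N + sum (δ x)               ≡⟨ cong (tot N +_) (sum-δ x) ⟩
    tot N + 1                       ≡⟨ +-comm (tot N) 1 ⟩
    suc (tot N)                     ∎
    where open ≡-Reasoning

  bump-present : ∀ N x a → 0 < bump N x a x a
  bump-present N x a = subst (λ e → 0 < N x a + e) (sym (cong₂ _*_ (δ-diag x) (δ-diag a))) (m≤n+m 1 (N x a))

  peel : ∀ N x a → 0 < N x a → ∃[ N′ ] N ≐ bump N′ x a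
  peel N x a pos = (λ u w → N u w ∸ δ x u * δ a w) , λ u w → sym (m∸n+n≡m (unit≤N u w))
    where
    unit≤N : ∀ u w → δ x u * δ a w ≤ N u w
    unit≤N u w with δ-view x u | δ-view a w
    ... | inj₁ refl | inj₁ refl = subst (_≤ N x a) (sym (cong₂ _*_ (δ-diag x) (δ-diag a))) pos
    ... | inj₁ refl | inj₂ δ≡0  = subst (_≤ N u w) (sym (trans (cong (δ x x *_) δ≡0) (*-zeroʳ (δ x x)))) z≤n
    ... | inj₂ δ≡0  | _         = subst (_≤ N u w) (sym (cong (_* δ a w) δ≡0)) z≤n

  peelRow : ∀ N x → 0 < row N x → ∃[ a ] ∃[ N′ ] N ≐ bump N′ x a
  peelRow N x pos with sum-positive (N x) pos
  ... | a , Nxa>0 = a , peel N x a Nxa>0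

  peelCol : ∀ N a → 0 < col N a → ∃[ x ] ∃[ N′ ] N ≐ bump N′ x a
  peelCol N a pos with sum-positive (λ x → N x a) pos
  ... | x , Nxa>0 = x , peel N x a Nxa>0

tr : ∀ {m n} → Mx m n → Mx n m
tr N a x = N x a

tot-tr : ∀ {m n} (N : Mx m n) → tot (tr N) ≡ tot N
tot-tr N = sym (∑-comm N)

record Split {m n} (N : Mx m n) : Set where
  field
    red blue : Mx m n
    covers   : ∀ x a → red x a + blue x a ≡ N x a
    rowBal   : ∀ x → ∣ row red x - row blue x ∣ ≤ 1
    colBal   : ∀ a → ∣ col red a - col blue a ∣ ≤ 1

-- Adding the same amount to both degrees preserves balance; the equalities
-- let the new degrees be given in whatever form they arise.
shiftBal : ∀ {p q p′ q′} k → p′ ≡ p + k → q′ ≡ q + k → ∣ p - q ∣ ≤ 1 → ∣ p′ - q′ ∣ ≤ 1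
shiftBal {p} {q} k refl refl bal = subst (_≤ 1) (sym (∣-∣-+ʳ p q k)) bal

module _ {m n} {N : Mx m n} (S : Split N) where
  open Split S

  row-split : ∀ x → row N x ≡ row red x + row blue x
  row-split x = trans (sym (row-cong covers x)) (∑-distrib-+ (red x) (blue x))

  col-split : ∀ a → col N a ≡ col red a + col blue a
  col-split a = trans (sym (col-cong covers a)) (∑-distrib-+ (λ x → red x a) (λ x → blue x a))

  red≤ : ∀ x a → red x a ≤ N x a
  red≤ x a = subst (red x a ≤_) (covers x a) (m≤m+n (red x a) (blue x a))

  edgeColour : ∀ x a → 0 < N x a → 0 < red x a ⊎ 0 < blue x a
  edgeColour x a present with red x a in red≡
  ... | suc _ = inj₁ (s≤s z≤n)
  ... | zero  = inj₂ (subst (0 <_) (trans (sym (covers x a)) (cong (_+ blue x a) red≡)) present)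

module _ {m n : ℕ} where

  swapColours : ∀ {N : Mx m n} → Split N → Split N
  swapColours S = record
    { red    = blue
    ; blue   = red
    ; covers = λ x a → trans (+-comm (blue x a) (red x a)) (covers x a)
    ; rowBal = λ x → subst (_≤ 1) (∣-∣-comm (row red x) (row blue x)) (rowBal x)
    ; colBal = λ a → subst (_≤ 1) (∣-∣-comm (col red a) (col blue a)) (colBal a)
    } where open Split S

  transposeSplit : ∀ {N : Mx m n} → Split (tr N) → Split N
  transposeSplit S = record
    { red = tr red ; blue = tr blue ; covers = λ x a → covers a x
    ; rowBal = colBal ; colBal = rowBal
    } where open Split S

  trivialSplit : ∀ (N : Mx m n) → (∀ x → row N x ≤ 1) → (∀ a → col N a ≤ 1) → Split N
  trivialSplit N rows≤1 cols≤1 = record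
    { red    = N
    ; blue   = λ _ _ → 0
    ; covers = λ x a → +-identityʳ (N x a)
    ; rowBal = λ x → ∣-∣≤1 (rows≤1 x) (subst (_≤ 1) (sym (sum-replicate-zero n)) z≤n)
    ; colBal = λ a → ∣-∣≤1 (cols≤1 a) (subst (_≤ 1) (sym (sum-replicate-zero m)) z≤n)
    }

  starSplit : ∀ {N} (N₂ : Mx m n) x a b → N ≐ bump (bump N₂ x b) x a →
              col N₂ a ≡ 0 → col N₂ b ≡ 0 → Split N₂ → Split N
  starSplit {N} N₂ x a b N≐ colA colB S = record
    { red    = bump red x a
    ; blue   = bump blue x b
    ; covers = λ u w → trans (regroup (red u w) (blue u w) (δ x u * δ a w) (δ x u * δ b w))
                             (trans (cong (λ s → s + δ x u * δ b w + δ x u * δ a w) (covers u w))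
                                    (sym (N≐ u w)))
    ; rowBal = λ v → shiftBal (δ x v) (row-bump red x a v) (row-bump blue x b v) (rowBal v)
    ; colBal = newColBal
    }
    where
    open Split S
    regroup : ∀ r s e f → r + e + (s + f) ≡ r + s + f + e
    regroup = solve-∀

    emptyCol : ∀ c → col N₂ c ≡ 0 → col red c ≡ 0 × col blue c ≡ 0
    emptyCol c colC = m+n≡0⇒m≡0 (col red c) split≡0 , m+n≡0⇒n≡0 (col red c) split≡0
      where
      split≡0 : col red c + col blue c ≡ 0
      split≡0 = trans (sym (col-split S c)) colC

    balAtEmpty : ∀ c → col N₂ c ≡ 0 → ∣ col red c + δ a c - col blue c + δ b c ∣ ≤ 1
    balAtEmpty c colC with emptyCol c colC
    ... | red≡0 , blue≡0 rewrite red≡0 | blue≡0 = ∣-∣≤1 (δ-≤1 a c) (δ-≤1 b c)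

    newColBal : ∀ v → ∣ col (bump red x a) v - col (bump blue x b) v ∣ ≤ 1
    newColBal v rewrite col-bump red x a v | col-bump blue x b v with δ-view a v | δ-view b v
    ... | inj₁ refl | _         = balAtEmpty a colA
    ... | inj₂ _    | inj₁ refl = balAtEmpty b colB
    ... | inj₂ δa≡0 | inj₂ δb≡0 = shiftBal 0 (cong (col red v +_) δa≡0) (cong (col blue v +_) δb≡0) (colBal v)

  -- A split of N₃ + ya in which ya is red extends to N₃ + yb + xb + xa:
  -- the red edge ya is replaced by the red edges yb and xa, and xb is blue.
  -- Row degrees change by δ x on both sides, column degrees by δ b.
  reroute : ∀ {N} (N₃ : Mx m n) x y a b → N ≐ bump (bump (bump N₃ y b) x b) x a →
            (S : Split (bump N₃ y a)) → 0 < Split.red S y a → Split N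
  reroute {N} N₃ x y a b N≐ S ya-red with peel (Split.red S) y a ya-red
  ... | R₀ , red≐ = record
    { red    = bump (bump R₀ y b) x a
    ; blue   = bump blue x b
    ; covers = newCovers
    ; rowBal = λ v → shiftBal (δ x v) (newRedRow v) (row-bump blue x b v) (rowBal v)
    ; colBal = λ v → shiftBal (δ b v) (newRedCol v) (col-bump blue x b v) (colBal v)
    }
    where
    open Split S
    R₀+blue : ∀ u w → R₀ u w + blue u w ≡ N₃ u w
    R₀+blue u w = +-cancelʳ-≡ (δ y u * δ a w) _ _ (begin
      R₀ u w + blue u w + δ y u * δ a w  ≡⟨ xy∙z≈xz∙y (R₀ u w) (blue u w) (δ y u * δ a w) ⟩
      R₀ u w + δ y u * δ a w + blue u w  ≡⟨ cong (_+ blue u w) (red≐ u w) ⟨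
      red u w + blue u w                 ≡⟨ covers u w ⟩
      N₃ u w + δ y u * δ a w             ∎)
      where open ≡-Reasoning

    newCovers : ∀ u w → bump (bump R₀ y b) x a u w + bump blue x b u w ≡ N u w
    newCovers u w = trans (regroup (R₀ u w) (blue u w) (δ y u * δ b w) (δ x u * δ b w) (δ x u * δ a w))
                          (trans (cong (λ s → s + δ y u * δ b w + δ x u * δ b w + δ x u * δ a w) (R₀+blue u w))
                                 (sym (N≐ u w)))
      where
      regroup : ∀ r s e f g → r + e + g + (s + f) ≡ r + s + e + f + g
      regroup = solve-∀

    newRedRow : ∀ v → row (bump (bump R₀ y b) x a) v ≡ row red v + δ x v
    newRedRow v = begin
      row (bump (bump R₀ y b) x a) v  ≡⟨ row-bump (bump R₀ y b) x a v ⟩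
      row (bump R₀ y b) v + δ x v     ≡⟨ cong (_+ δ x v) (row-bump R₀ y b v) ⟩
      row R₀ v + δ y v + δ x v        ≡⟨ cong (_+ δ x v) (row-bump R₀ y a v) ⟨
      row (bump R₀ y a) v + δ x v     ≡⟨ cong (_+ δ x v) (row-cong red≐ v) ⟨
      row red v + δ x v               ∎
      where open ≡-Reasoning

    newRedCol : ∀ v → col (bump (bump R₀ y b) x a) v ≡ col red v + δ b v
    newRedCol v = begin
      col (bump (bump R₀ y b) x a) v  ≡⟨ col-bump (bump R₀ y b) x a v ⟩
      col (bump R₀ y b) v + δ a v     ≡⟨ cong (_+ δ a v) (col-bump R₀ y b v) ⟩
      col R₀ v + δ b v + δ a v        ≡⟨ xy∙z≈xz∙y (col R₀ v) (δ b v) (δ a v) ⟩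
      col R₀ v + δ a v + δ b v        ≡⟨ cong (_+ δ b v) (col-bump R₀ y a v) ⟨
      col (bump R₀ y a) v + δ b v     ≡⟨ cong (_+ δ b v) (col-cong red≐ v) ⟨
      col red v + δ b v               ∎
      where open ≡-Reasoning

  -- The path y–b–x–a can be shortcut to the edge y–a: a split of N₃ + ya
  -- extends to N₃ + yb + xb + xa, after swapping colours if ya is blue.
  pathSplit : ∀ {N} (N₃ : Mx m n) x y a b → N ≐ bump (bump (bump N₃ y b) x b) x a →
              Split (bump N₃ y a) → Split N
  pathSplit N₃ x y a b N≐ S with edgeColour S y a (bump-present N₃ y a)
  ... | inj₁ ya-red  = reroute N₃ x y a b N≐ S ya-red
  ... | inj₂ ya-blue = reroute N₃ x y a b N≐ (swapColours S) ya-blue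

  tot-peeled : ∀ {N} (N′ : Mx m n) x a → N ≐ bump N′ x a → tot N ≡ suc (tot N′)
  tot-peeled N′ x a N≐ = trans (tot-cong N≐) (tot-bump N′ x a)

  row-peeled : ∀ {N} (N′ : Mx m n) x a → N ≐ bump N′ x a → row N x ≡ suc (row N′ x)
  row-peeled {N} N′ x a N≐ = begin
    row N x               ≡⟨ row-cong N≐ x ⟩
    row (bump N′ x a) x   ≡⟨ row-bump N′ x a x ⟩
    row N′ x + δ x x      ≡⟨ cong (row N′ x +_) (δ-diag x) ⟩
    row N′ x + 1          ≡⟨ +-comm (row N′ x) 1 ⟩
    suc (row N′ x)        ∎
    where open ≡-Reasoning

  shortcut-smaller : ∀ {N} (N₃ : Mx m n) x y a b → N ≐ bump (bump (bump N₃ y b) x b) x a →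
                     ∀ c → tot (bump N₃ y c) < tot N
  shortcut-smaller N₃ x y a b N≐ c
    rewrite tot-peeled (bump (bump N₃ y b) x b) x a N≐ | tot-bump (bump N₃ y b) x b | tot-bump N₃ y b | tot-bump N₃ y c
    = m<n⇒m<1+n (n<1+n _)

  twoEdgesAt : ∀ N x → 2 ≤ row N x → ∃[ a ] ∃[ b ] ∃[ N₂ ] N ≐ bump (bump N₂ x b) x a
  twoEdgesAt N x two with peelRow N x (≤-trans (s≤s z≤n) two)
  ... | a , N₁ , N≐ with peelRow N₁ x (≤-pred (subst (2 ≤_) (row-peeled N₁ x a N≐) two))
  ...   | b , N₂ , N₁≐ = a , b , N₂ , λ u w → trans (N≐ u w) (bump-cong x a N₁≐ u w)

  SplitBelow : Mx m n → Set
  SplitBelow N = ∀ {N′ : Mx m n} → tot N′ < tot N → Split N′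

  -- If some other edge yb (or ya) exists, shortcut the path y–b–x–a (or
  -- y–a–x–b); otherwise xa, xb are the only edges at a and b (a star).
  rowReduce : ∀ N → SplitBelow N → ∀ x → 2 ≤ row N x → Split N
  rowReduce N splitBelow x two with twoEdgesAt N x two
  ... | a , b , N₂ , N≐ with 1 ≤? col N₂ b | 1 ≤? col N₂ a
  ... | yes yb-exists | _ with peelCol N₂ b yb-exists
  ...   | y , N₃ , N₂≐ = pathSplit N₃ x y a b path (splitBelow (shortcut-smaller N₃ x y a b path a))
    where
    path : N ≐ bump (bump (bump N₃ y b) x b) x a
    path u w = trans (N≐ u w) (bump-cong x a (bump-cong x b N₂≐) u w)
  rowReduce N splitBelow x two | a , b , N₂ , N≐ | no _ | yes ya-exists with peelCol N₂ a ya-exists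
  ...   | y , N₃ , N₂≐ = pathSplit N₃ x y b a path (splitBelow (shortcut-smaller N₃ x y b a path b))
    where
    path : N ≐ bump (bump (bump N₃ y a) x a) x b
    path u w = trans (N≐ u w) (trans (bump-cong x a (bump-cong x b N₂≐) u w)
                                     (bump-comm (bump N₃ y a) x b x a u w))
  rowReduce N splitBelow x two | a , b , N₂ , N≐ | no no-yb | no no-ya =
    starSplit N₂ x a b N≐ (n≤0⇒n≡0 (≮⇒≥ no-ya)) (n≤0⇒n≡0 (≮⇒≥ no-yb)) (splitBelow star-smaller)
    where
    star-smaller : tot N₂ < tot N
    star-smaller rewrite tot-peeled (bump N₂ x b) x a N≐ | tot-bump N₂ x b = m<n⇒m<1+n (n<1+n (tot N₂))

splitStep : ∀ {m n} (N : Mx m n) → SplitBelow N → Split N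
splitStep N splitBelow with any? (λ x → 2 ≤? row N x)
... | yes (x , two) = rowReduce N splitBelow x two
... | no rows≤1 with any? (λ a → 2 ≤? col N a)
...   | yes (a , two) = transposeSplit (rowReduce (tr N) splitBelowᵀ a two)
  where
  splitBelowᵀ : SplitBelow (tr N)
  splitBelowᵀ {N′} smaller =
    transposeSplit (splitBelow (subst₂ _<_ (sym (tot-tr N′)) (tot-tr N) smaller))
...   | no cols≤1 = trivialSplit N (λ x → ≤-pred (≰⇒> (λ two → rows≤1 (x , two))))
                                   (λ a → ≤-pred (≰⇒> (λ two → cols≤1 (a , two))))

split : ∀ {m n} (N : Mx m n) → Split N
split = All.wfRec (On.wellFounded tot <-wellFounded) 0ℓ Split splitStep

bit : Bool → ℕ
bit true  = 1
bit false = 0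

T-bit : ∀ {b} → 0 < bit b → T b
T-bit {true} _ = tt

bit-≤1 : ∀ b → bit b ≤ 1
bit-≤1 true  = ≤-refl
bit-≤1 false = z≤n

bit-positive : ∀ {k} → k ≤ 1 → bit (0 <ᵇ k) ≡ k
bit-positive {zero}        _ = refl
bit-positive {suc zero}    _ = refl
bit-positive {suc (suc k)} (s≤s ())

count-tabulate : ∀ {m k} (p : Fin m → Bool) (g : Fin k → Fin m) →
                 length (filter (T? ∘ p) (tabulate g)) ≡ sum (bit ∘ p ∘ g)
count-tabulate {k = zero}  p g = refl
count-tabulate {k = suc k} p g with p (g zero)
... | true  = cong suc (count-tabulate p (g ∘ suc))
... | false = count-tabulate p (g ∘ suc)

nbr : ∀ {n} → Graph n → Fin n → Fin n → ℕ
nbr G v u = bit (adj G v u)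

degree-sum : ∀ {n} (G : Graph n) v → degree G v ≡ sum (nbr G v)
degree-sum G v = count-tabulate (adj G v) (λ u → u)

⊆-trans : ∀ {n} {A B C : Graph n} → A ⊆ᴳ B → B ⊆ᴳ C → A ⊆ᴳ C
⊆-trans A⊆B B⊆C u w = B⊆C u w ∘ A⊆B u w

module _ {n : ℕ} (G : Graph n) where

  -- Orienting every edge from its smaller to its larger endpoint makes G a
  -- bipartite graph between two copies of its vertex set.
  orient : Mx n n
  orient u w = bit (adj G u w ∧ does (u <ᶠ? w))

  orient-split : ∀ v w → bit (adj G v w) ≡ orient v w + orient w v
  orient-split v w with <ᶠ-cmp v w
  ... | tri< v<w _ w≮v rewrite dec-true (v <ᶠ? w) v<w | dec-false (w <ᶠ? v) w≮v
                             | ∧-identityʳ (adj G v w) | ∧-zeroʳ (adj G w v) = sym (+-identityʳ _)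
  ... | tri> v≮w _ w<v rewrite dec-false (v <ᶠ? w) v≮w | dec-true (w <ᶠ? v) w<v
                             | ∧-identityʳ (adj G w v) | ∧-zeroʳ (adj G v w) = cong bit (Graph.sym G v w)
  ... | tri≈ _ refl _  rewrite irrefl G v = refl

  degree-orient : ∀ v → degree G v ≡ row orient v + col orient v
  degree-orient v = begin
    degree G v                              ≡⟨ degree-sum G v ⟩
    sum (nbr G v)                           ≡⟨ sum-cong-≗ (orient-split v) ⟩
    sum (λ w → orient v w + orient w v)     ≡⟨ ∑-distrib-+ (orient v) (λ w → orient w v) ⟩
    row orient v + col orient v             ∎
    where open ≡-Reasoning

  unorient : (R : Mx n n) → (∀ u w → R u w ≤ orient u w) →
             Σ (Graph n) λ H → H ⊆ᴳ G × (∀ v → degree H v ≡ row R v + col R v)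
  unorient R R≤ = H , H⊆G , degreeH
    where
    both≤ : ∀ u w → R u w + R w u ≤ bit (adj G u w)
    both≤ u w = subst (R u w + R w u ≤_) (sym (orient-split u w)) (+-mono-≤ (R≤ u w) (R≤ w u))

    loopless : ∀ v → R v v ≡ 0
    loopless v = n≤0⇒n≡0 (subst (R v v ≤_) (cong (λ b → bit (b ∧ does (v <ᶠ? v))) (irrefl G v)) (R≤ v v))

    H : Graph n
    H = record
      { adj    = λ u w → 0 <ᵇ R u w + R w u
      ; sym    = λ u w → cong (0 <ᵇ_) (+-comm (R u w) (R w u))
      ; irrefl = λ v → cong (λ k → 0 <ᵇ k + k) (loopless v)
      }

    H⊆G : H ⊆ᴳ G
    H⊆G u w uw∈H = T-bit (<-≤-trans (<ᵇ⇒< 0 _ uw∈H) (both≤ u w))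

    degreeH : ∀ v → degree H v ≡ row R v + col R v
    degreeH v = begin
      degree H v                 ≡⟨ degree-sum H v ⟩
      sum (nbr H v)              ≡⟨ sum-cong-≗ (λ w → bit-positive (≤-trans (both≤ v w) (bit-≤1 (adj G v w)))) ⟩
      sum (λ w → R v w + R w v)  ≡⟨ ∑-distrib-+ (R v) (λ w → R w v) ⟩
      row R v + col R v          ∎
      where open ≡-Reasoning

IsHalf : ∀ {n} → Graph n → Graph n → Set
IsHalf H G = H ⊆ᴳ G × (∀ v → ∣ 2 * degree H v - degree G v ∣ ≤ 2)

IsFraction : ∀ {n} → ℕ → Graph n → Graph n → Set
IsFraction r K G = K ⊆ᴳ G × (∀ v → ∣ 2 ^ r * degree K v - degree G v ∣ + 2 ≤ 2 ^ suc r)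

halfFromSplit : ∀ {n} (G : Graph n) → Split (orient G) → Σ (Graph n) λ H → IsHalf H G
halfFromSplit G S with unorient G (Split.red S) (red≤ S)
... | H , H⊆G , degreeH = H , H⊆G , bound
  where
  open Split S
  bound : ∀ v → ∣ 2 * degree H v - degree G v ∣ ≤ 2
  bound v = begin
    ∣ 2 * degree H v - degree G v ∣             ≡⟨ cong₂ (λ h g → ∣ 2 * h - g ∣) (degreeH v) degreeG ⟩
    ∣ 2 * (rR + cR) - (rR + cR) + (rB + cB) ∣   ≡⟨ ∣double-sum∣ (rR + cR) (rB + cB) ⟩
    ∣ rR + cR - rB + cB ∣                       ≤⟨ ∣-∣-+-≤ rR rB cR cB ⟩
    ∣ rR - rB ∣ + ∣ cR - cB ∣                   ≤⟨ +-mono-≤ (rowBal v) (colBal v) ⟩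
    2                                           ∎
    where
    open ≤-Reasoning
    rR = row red v ; rB = row blue v ; cR = col red v ; cB = col blue v
    degreeG : degree G v ≡ rR + cR + (rB + cB)
    degreeG = trans (degree-orient G v)
                (trans (cong₂ _+_ (row-split S v) (col-split S v)) (interchange rR rB cR cB))

half : ∀ {n} (G : Graph n) → Σ (Graph n) λ H → IsHalf H G
half G = halfFromSplit G (split (orient G))

halving-step : ∀ r {l k g} → ∣ 2 * l - k ∣ ≤ 2 → ∣ 2 ^ r * k - g ∣ + 2 ≤ 2 ^ suc r →
               ∣ 2 ^ suc r * l - g ∣ + 2 ≤ 2 ^ suc (suc r)
halving-step r {l} {k} {g} halfL boundK = begin
  ∣ 2 ^ suc r * l - g ∣ + 2                 ≡⟨ cong (λ s → ∣ s - g ∣ + 2) (regroup t l) ⟩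
  ∣ t * (2 * l) - g ∣ + 2                   ≤⟨ +-monoˡ-≤ 2 (∣-∣-triangle (t * (2 * l)) (t * k) g) ⟩
  ∣ t * (2 * l) - t * k ∣ + ∣ t * k - g ∣ + 2
    ≡⟨ cong (λ s → s + ∣ t * k - g ∣ + 2) (*-distribˡ-∣-∣ t (2 * l) k) ⟨
  t * ∣ 2 * l - k ∣ + ∣ t * k - g ∣ + 2     ≡⟨ +-assoc (t * ∣ 2 * l - k ∣) (∣ t * k - g ∣) 2 ⟩
  t * ∣ 2 * l - k ∣ + (∣ t * k - g ∣ + 2)   ≤⟨ +-mono-≤ (*-monoʳ-≤ t halfL) boundK ⟩
  t * 2 + 2 * t                             ≡⟨ double t ⟩
  2 * (2 * t)                               ∎
  where
  open ≤-Reasoning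
  t = 2 ^ r
  regroup : ∀ t l → 2 * t * l ≡ t * (2 * l)
  regroup = solve-∀
  double : ∀ t → t * 2 + 2 * t ≡ 2 * (2 * t)
  double = solve-∀

dyadic : ∀ {n} r (G : Graph n) → Σ (Graph n) λ K → IsFraction r K G
dyadic zero G = G , (λ u w uw∈G → uw∈G) , exact
  where
  exact : ∀ v → ∣ 1 * degree G v - degree G v ∣ + 2 ≤ 2
  exact v = ≤-reflexive (cong (_+ 2) (trans (cong (∣_- degree G v ∣) (*-identityˡ (degree G v)))
                                            (∣n-n∣≡0 (degree G v))))
dyadic (suc r) G with dyadic r G
... | K , K⊆G , boundK with half K
...   | L , L⊆K , halfL = L , ⊆-trans {A = L} {K} {G} L⊆K K⊆G , λ v → halving-step r (halfL v) (boundK v)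

Disjoint : ∀ {n} → Graph n → Graph n → Set
Disjoint H K = ∀ u w → T (adj H u w) → T (adj K u w) → ⊥

module _ {n : ℕ} where

  _∖_ : Graph n → Graph n → Graph n
  G ∖ H = record
    { adj    = λ u w → adj G u w ∧ not (adj H u w)
    ; sym    = λ u w → cong₂ (λ g h → g ∧ not h) (Graph.sym G u w) (Graph.sym H u w)
    ; irrefl = λ v → cong (_∧ not (adj H v v)) (irrefl G v)
    }

  _∪_ : Graph n → Graph n → Graph n
  H ∪ K = record
    { adj    = λ u w → adj H u w ∨ adj K u w
    ; sym    = λ u w → cong₂ _∨_ (Graph.sym H u w) (Graph.sym K u w)
    ; irrefl = λ v → cong₂ _∨_ (irrefl H v) (irrefl K v)
    }

  ∖-⊆ : ∀ G H → (G ∖ H) ⊆ᴳ G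
  ∖-⊆ G H u w uw∈G∖H = proj₁ (Equivalence.to (T-∧ {adj G u w}) uw∈G∖H)

  ⊆∖-disjoint : ∀ {G H K} → K ⊆ᴳ (G ∖ H) → Disjoint H K
  ⊆∖-disjoint {G} {H} K⊆G∖H u w uw∈H uw∈K = subst T uw∉H uw∈H
    where
    uw∉H : adj H u w ≡ false
    uw∉H = Equivalence.to (T-not-≡ {adj H u w}) (proj₂ (Equivalence.to (T-∧ {adj G u w}) (K⊆G∖H u w uw∈K)))

  ∪-⊆ : ∀ {G H K} → H ⊆ᴳ G → K ⊆ᴳ G → (H ∪ K) ⊆ᴳ G
  ∪-⊆ {H = H} H⊆G K⊆G u w uw∈H∪K with Equivalence.to (T-∨ {adj H u w}) uw∈H∪K
  ... | inj₁ uw∈H = H⊆G u w uw∈H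
  ... | inj₂ uw∈K = K⊆G u w uw∈K

  degree-∖ : ∀ {G H} → H ⊆ᴳ G → ∀ v → degree H v + degree (G ∖ H) v ≡ degree G v
  degree-∖ {G} {H} H⊆G v = begin
    degree H v + degree (G ∖ H) v            ≡⟨ cong₂ _+_ (degree-sum H v) (degree-sum (G ∖ H) v) ⟩
    sum (nbr H v) + sum (nbr (G ∖ H) v)      ≡⟨ ∑-distrib-+ (nbr H v) (nbr (G ∖ H) v) ⟨
    sum (λ u → nbr H v u + nbr (G ∖ H) v u)  ≡⟨ sum-cong-≗ (λ u → bit-∖ (adj G v u) (adj H v u) (H⊆G v u)) ⟩
    sum (nbr G v)                            ≡⟨ degree-sum G v ⟨
    degree G v                               ∎
    where
    open ≡-Reasoning
    bit-∖ : ∀ g h → (T h → T g) → bit h + bit (g ∧ not h) ≡ bit g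
    bit-∖ true  true  _   = refl
    bit-∖ true  false _   = refl
    bit-∖ false true  h⇒g = ⊥-elim (h⇒g tt)
    bit-∖ false false _   = refl

  degree-∪ : ∀ {H K} → Disjoint H K → ∀ v → degree (H ∪ K) v ≡ degree H v + degree K v
  degree-∪ {H} {K} disjoint v = begin
    degree (H ∪ K) v                   ≡⟨ degree-sum (H ∪ K) v ⟩
    sum (nbr (H ∪ K) v)                ≡⟨ sum-cong-≗ (λ u → bit-∨ (adj H v u) (adj K v u) (disjoint v u)) ⟩
    sum (λ u → nbr H v u + nbr K v u)  ≡⟨ ∑-distrib-+ (nbr H v) (nbr K v) ⟩
    sum (nbr H v) + sum (nbr K v)      ≡⟨ cong₂ _+_ (degree-sum H v) (degree-sum K v) ⟨
    degree H v + degree K v            ∎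
    where
    open ≡-Reasoning
    bit-∨ : ∀ h k → (T h → T k → ⊥) → bit (h ∨ k) ≡ bit h + bit k
    bit-∨ true  true  not-both = ⊥-elim (not-both tt tt)
    bit-∨ true  false _        = refl
    bit-∨ false k     _        = refl

-- The arithmetic of 9/16 = 1/2 + 1/16: if d = h + c with |2h - d| ≤ 2 and
-- |8k - c| ≤ 14, then |16(h + k) - 9d| ≤ 7|h - c| + 2|8k - c| ≤ 42.
nine-sixteenths : ∀ {d h c k} → h + c ≡ d → ∣ 2 * h - d ∣ ≤ 2 → ∣ 2 ^ 3 * k - c ∣ + 2 ≤ 2 ^ 4 →
                  ∣ 16 * (h + k) - 9 * d ∣ ≤ 48
nine-sixteenths {_} {h} {c} {k} refl halfH eighthK = begin
  ∣ 16 * (h + k) - 9 * (h + c) ∣                            ≡⟨ cong₂ ∣_-_∣ (split16 h k) (split9 h c) ⟩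
  ∣ 9 * h + (7 * h + 2 * (8 * k)) - 9 * h + (7 * c + 2 * c) ∣ ≡⟨ ∣m+n-m+o∣≡∣n-o∣ (9 * h) _ _ ⟩
  ∣ 7 * h + 2 * (8 * k) - 7 * c + 2 * c ∣                   ≤⟨ ∣-∣-+-≤ (7 * h) (7 * c) (2 * (8 * k)) (2 * c) ⟩
  ∣ 7 * h - 7 * c ∣ + ∣ 2 * (8 * k) - 2 * c ∣               ≡⟨ cong₂ _+_ (*-distribˡ-∣-∣ 7 h c) (*-distribˡ-∣-∣ 2 (8 * k) c) ⟨
  7 * ∣ h - c ∣ + 2 * ∣ 8 * k - c ∣                         ≤⟨ +-mono-≤ (*-monoʳ-≤ 7 h≈c) (*-monoʳ-≤ 2 8k≈c) ⟩
  42                                                        ≤⟨ m≤m+n 42 6 ⟩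
  48                                                        ∎
  where
  open ≤-Reasoning
  split16 : ∀ h k → 16 * (h + k) ≡ 9 * h + (7 * h + 2 * (8 * k))
  split16 = solve-∀
  split9 : ∀ h c → 9 * (h + c) ≡ 9 * h + (7 * c + 2 * c)
  split9 = solve-∀
  h≈c : ∣ h - c ∣ ≤ 2
  h≈c = subst (_≤ 2) (∣double-sum∣ h c) halfH
  8k≈c : ∣ 8 * k - c ∣ ≤ 14
  8k≈c = +-cancelʳ-≤ 2 (∣ 8 * k - c ∣) 14 eighthK

half-plus-eighth : ∀ {n} {G H K : Graph n} → IsHalf H G → IsFraction 3 K (G ∖ H) →
                   (H ∪ K) ⊆ᴳ G × (∀ v → ∣ 16 * degree (H ∪ K) v - 9 * degree G v ∣ ≤ 48)
half-plus-eighth {G = G} {H} {K} (H⊆G , halfH) (K⊆G∖H , eighthK) = H∪K⊆G , deviation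
  where
  H∪K⊆G : (H ∪ K) ⊆ᴳ G
  H∪K⊆G = ∪-⊆ {G = G} {H} {K} H⊆G (⊆-trans {A = K} {G ∖ H} {G} K⊆G∖H (∖-⊆ G H))
  deviation : ∀ v → ∣ 16 * degree (H ∪ K) v - 9 * degree G v ∣ ≤ 48
  deviation v = subst (λ g → ∣ 16 * g - 9 * degree G v ∣ ≤ 48) (sym degree-H∪K)
                  (nine-sixteenths {degree G v} {degree H v} {degree (G ∖ H) v} {degree K v}
                    (degree-∖ {G = G} {H} H⊆G v) (halfH v) (eighthK v))
    where
    degree-H∪K : degree (H ∪ K) v ≡ degree H v + degree K v
    degree-H∪K = degree-∪ {H = H} {K} (⊆∖-disjoint {G = G} {H} {K} K⊆G∖H) v

corollary6 : (n : ℕ) (G : Graph n) →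
    Σ (Graph n) (λ G' → G' ⊆ᴳ G ×
      (∀ v → (9 * degree G v ≤ 16 * degree G' v + 48)
           × (16 * degree G' v ≤ 9 * degree G v + 48)))
corollary6 n G = H ∪ K , proj₁ H∪K-good , λ v → ∣-∣≤⇒bounds (proj₂ H∪K-good v)
  where
  H : Graph n
  H = proj₁ (half G)
  K : Graph n
  K = proj₁ (dyadic 3 (G ∖ H))
  H∪K-good : (H ∪ K) ⊆ᴳ G × (∀ v → ∣ 16 * degree (H ∪ K) v - 9 * degree G v ∣ ≤ 48)
  H∪K-good = half-plus-eighth {G = G} {H} {K} (proj₂ (half G)) (proj₂ (dyadic 3 (G ∖ H)))
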